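{- Let $n\ge2$ be an integer and let $\beta$ be the largest real root of $p_n(x)=x^3-(n+1)x^2+nx-n$. Then every integer $k$ with $1\le k\le n(n-1)$ belongs to $\mathrm{Fin}(\beta)$.
   Context: $\beta$ is a Pisot number with $\lfloor\beta\rfloor=n$ and $\beta$-expansion of $1$ equal to $n\,1\,0\,n$. For a real non-integer $\beta>1$, the $\beta$-expansion of $x\in[0,1]$ is the digit sequence $e_k(x)=\lfloor \beta T_\beta^{k-1}(x)\rfloor$ where $T_\beta(x)=\beta x-\lfloor\beta x\rfloor$; for $x>1$, with $L$ the least natural number such that $x\le\beta^L$, the $\beta$-expansion of $x$ is that of $x/\beta^L$ shifted $L$ places left. $\mathrm{Fin}(\beta)$ is the set of numbers whose $\beta$-expansion has finitely many nonzero digits. -}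

module Defs where

open import Level using (Level; _⊔_; suc)
open import Algebra.Bundles using (CommutativeRing)
open import Relation.Binary.Structures using (IsStrictTotalOrder)
open import Data.Nat as ℕ using (ℕ; zero)
open import Data.Integer as ℤ using (ℤ; +_; -[1+_])
open import Data.Product using (Σ; ∃; _×_; _,_)
open import Data.Sum using (_⊎_)
open import Relation.Nullary using (¬_)
open import Relation.Binary.PropositionalEquality using (_≡_)

module RingHelpers {c ℓ ℓ′} (R : CommutativeRing c ℓ) (_<_ : CommutativeRing.Carrier R → CommutativeRing.Carrier R → Set ℓ′) where
  open CommutativeRing R
  infix 4 _≤_
  _≤_ : Carrier → Carrier → Set (ℓ ⊔ ℓ′)
  x ≤ y = (x < y) ⊎ (x ≈ y)

  ιℕ : ℕ → Carrier
  ιℕ zero      = 0#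
  ιℕ (ℕ.suc m) = 1# + ιℕ m

  ι : ℤ → Carrier
  ι (+ m)      = ιℕ m
  ι -[1+ m ]   = - ιℕ (ℕ.suc m)

  _^_ : Carrier → ℕ → Carrier
  x ^ zero      = 1#
  x ^ ℕ.suc m   = x * (x ^ m)


-- The real numbers
-- are the intended model; every field operation needed by the statement
-- happens inside ℚ(β), so the statement is stated for every such field.
record ArchOrderedField (c ℓ : Level) : Set (suc (c ⊔ ℓ)) where
  field
    commRing : CommutativeRing c ℓ
  open CommutativeRing commRing public
  field
    _<_               : Carrier → Carrier → Set ℓ
    isStrictTotalOrder : IsStrictTotalOrder _≈_ _<_
    0<1               : 0# < 1#
    +-mono-<          : ∀ {x y} z → x < y → (x + z) < (y + z)
    *-pos             : ∀ {x y} → 0# < x → 0# < y → 0# < (x * y)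
    inverse           : ∀ x → ¬ (x ≈ 0#) → Σ Carrier λ y → (x * y) ≈ 1#
  open RingHelpers commRing _<_ public

  field
    ⌊_⌋       : Carrier → ℤ
    ⌊⌋-lower  : ∀ x → ι ⌊ x ⌋ ≤ x
    ⌊⌋-upper  : ∀ x → x < (ι ⌊ x ⌋ + 1#)

module BetaExpansion {c ℓ} (F : ArchOrderedField c ℓ) where
  open ArchOrderedField F

  pₙ : ℕ → Carrier → Carrier
  pₙ n x = (((x ^ 3) - (ιℕ (ℕ.suc n) * (x ^ 2))) + (ιℕ n * x)) - ιℕ n

  IsLargestRoot : ℕ → Carrier → Set (c ⊔ ℓ)
  IsLargestRoot n β = (pₙ n β ≈ 0#) × (∀ y → pₙ n y ≈ 0# → y ≤ β)

  T : Carrier → Carrier → Carrier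
  T β x = (β * x) - ι ⌊ β * x ⌋

  Tⁱ : Carrier → ℕ → Carrier → Carrier
  Tⁱ β zero      x = x
  Tⁱ β (ℕ.suc j) x = T β (Tⁱ β j x)

  -- digit e_{j+1}(x) = ⌊ β T_β^j(x) ⌋  (digits indexed from 0 here)
  digit : Carrier → Carrier → ℕ → ℤ
  digit β x j = ⌊ β * Tⁱ β j x ⌋

  FiniteDigits : Carrier → Carrier → Set
  FiniteDigits β y = ∃ λ N → ∀ j → N ℕ.≤ j → digit β y j ≡ + 0

  -- x ≥ 0 lies in Fin(β): with L the least natural number such that
  -- x ≤ β^L, the β-expansion of x / β^L has finitely many nonzero digits.
  -- (For x ∈ [0,1], L = 0 and this is the expansion of x itself.)
  InFin : Carrier → Carrier → Set (c ⊔ ℓ)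
  InFin β x = ∃ λ L → (x ≤ (β ^ L)) × (∀ L′ → L′ ℕ.< L → ¬ (x ≤ (β ^ L′)))
              × Σ Carrier λ y → ((y * (β ^ L)) ≈ x) × FiniteDigits β y

{-# OPTIONS --safe #-}
module Submission where

-- p_n(β) = 0 reads β (β − 1) z = n with z = β − n, which forces n < β < n + 1 and
-- n β + 1 < β².  Then 1 = .n 1 0 n 0 and k/β = .k for 2 ≤ k ≤ n.  For n < k ≤ n(n − 1)
-- write k − 1 = q n + s with 1 ≤ q ≤ n − 2, so that k/β² = .q s followed by the digits of
-- ρ q = 1 − q z.  Explicit blocks of digits lead from ρ q, through the remainders
-- 1 − q z + 2 j w and 1 − q z + q w + 2 j z (where w = z/β), to ρ (q − 1), and from ρ 1
-- to 0; each block is a polynomial identity in β modulo p_n(β).  All digits are below n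
-- except a final "n 0", and since n β + 1 < β² every tail of such a string has value
-- below 1, so these are exactly the digits produced by the β-transformation.

open import Defs
open import Algebra.Bundles.Raw using (RawRing)
open import Data.Integer as ℤ using (ℤ; +_; -[1+_])
import Data.Integer.Properties as ℤ
open import Data.List as List using (List; []; _∷_; _++_; length)
import Data.List.Properties as List
open import Data.List.Relation.Unary.All as All using (All)
import Data.List.Relation.Unary.All.Properties as All
open import Data.Maybe using (Maybe; just; nothing)
open import Data.Nat as ℕ using (ℕ; zero; suc)
import Data.Nat.Properties as ℕ
import Data.Nat.DivMod as DivMod
import Data.Nat.Tactic.RingSolver as ℕ-Solver
open import Data.Empty using (⊥-elim)
open import Data.Product using (Σ-syntax; _×_; _,_; proj₁; proj₂)
open import Data.Sum using (_⊎_; inj₁; inj₂)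
open import Relation.Binary.Bundles using (Preorder; StrictTotalOrder)
open import Relation.Binary.Definitions using (tri<; tri≈; tri>)
open import Relation.Binary.PropositionalEquality as ≡ using (_≡_)
open import Relation.Nullary using (¬_; yes; no)
import Relation.Binary.Construct.StrictToNonStrict as NonStrict
import Relation.Binary.Reasoning.Setoid as SetoidReasoning
import Relation.Binary.Reasoning.StrictPartialOrder as StrictReasoning
import Relation.Binary.Reasoning.Preorder as PreorderReasoning

-- Stated over a raw ring so that the same formulas serve both in the field and, over
-- polynomial syntax, inside ring-solver identities.
module RingFormulas {c ℓ} (R : RawRing c ℓ) where
  open RawRing R
  open import Algebra.Definitions.RawSemiring rawSemiring using (_^_)

  infixl 6 _-_
  _-_ : Carrier → Carrier → Carrier
  x - y = x + - y

  value : Carrier → List Carrier → Carrier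
  value β []       = 0#
  value β (d ∷ ds) = d * β ^ length ds + value β ds

  module Root (β N : Carrier) where
    cubic z w : Carrier
    cubic = β ^ 3 - (1# + N) * β ^ 2 + N * β - N
    z     = β - N
    w     = 1# - (β - 1#) * z       -- equals z/β once cubic = 0

    ρ : Carrier → Carrier
    ρ Q = 1# - Q * z

    ρᴬ ρᴮ : Carrier → Carrier → Carrier
    ρᴬ Q J = ρ Q + (1# + 1#) * J * w
    ρᴮ Q J = ρ Q + Q * w + (1# + 1#) * J * z

-- A block's digits are written once, as a function of its atoms: with ℕ atoms ⟦_⟧ℕ gives
-- the digits, and with solver variables as atoms ⌜_⌝ gives syntax whose semantics is
-- definitionally ⟦_⟧ᶠ of the ℕ version.  Literals (#) and atoms (⟨_⟩) are kept apart
-- because they are cast into the field differently (by ιᶻ and by ιℕ).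
infixl 6 _⊕_
infixl 7 _⊛_

data ℕExpr {a} (X : Set a) : Set a where
  #_      : ℕ → ℕExpr X
  ⟨_⟩     : X → ℕExpr X
  _⊕_ _⊛_ : ℕExpr X → ℕExpr X → ℕExpr X

⟦_⟧ℕ : ℕExpr ℕ → ℕ
⟦ # c     ⟧ℕ = c
⟦ ⟨ x ⟩   ⟧ℕ = x
⟦ e ⊕ e′ ⟧ℕ = ⟦ e ⟧ℕ ℕ.+ ⟦ e′ ⟧ℕ
⟦ e ⊛ e′ ⟧ℕ = ⟦ e ⟧ℕ ℕ.* ⟦ e′ ⟧ℕ

data Parity : ℕ → Set where
  even : ∀ m → Parity (m ℕ.* 2)
  odd  : ∀ m → Parity (1 ℕ.+ m ℕ.* 2)

parity : ∀ n → Parity n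
parity 0 = even 0
parity 1 = odd 0
parity (suc (suc n)) with parity n
... | even m = even (suc m)
... | odd m  = odd (suc m)

quotient-bounds : ∀ {n m} .{{_ : ℕ.NonZero n}} → n ℕ.≤ m → suc m ℕ.≤ n ℕ.* (n ℕ.∸ 1) →
                  1 ℕ.≤ m ℕ./ n × m ℕ./ n ℕ.+ 2 ℕ.≤ n
quotient-bounds {n} {m} n≤m 1+m≤n[n-1] = ℕ.≤-pred 1<1+q , q+2≤n
  where
  open ℕ.≤-Reasoning
  q : ℕ
  q = m ℕ./ n
  m≡ : m ≡ m ℕ.% n ℕ.+ q ℕ.* n
  m≡ = DivMod.m≡m%n+[m/n]*n m n
  q*n≤m : q ℕ.* n ℕ.≤ m
  q*n≤m = ℕ.≤-trans (ℕ.m≤n+m (q ℕ.* n) (m ℕ.% n)) (ℕ.≤-reflexive (≡.sym m≡))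
  1<1+q : 1 ℕ.< suc q
  1<1+q = ℕ.*-cancelʳ-< n 1 (suc q) (begin-strict
    1 ℕ.* n                      ≡⟨ ℕ.*-identityˡ n ⟩
    n                            ≤⟨ n≤m ⟩
    m                            ≡⟨ m≡ ⟩
    m ℕ.% n ℕ.+ q ℕ.* n          <⟨ ℕ.+-monoˡ-< (q ℕ.* n) (DivMod.m%n<n m n) ⟩
    suc q ℕ.* n                  ∎)
  q<n-1 : q ℕ.< n ℕ.∸ 1
  q<n-1 = ℕ.*-cancelʳ-< n q (n ℕ.∸ 1) (begin-strict
    q ℕ.* n                      ≤⟨ q*n≤m ⟩
    m                            <⟨ 1+m≤n[n-1] ⟩
    n ℕ.* (n ℕ.∸ 1)              ≡⟨ ℕ.*-comm n (n ℕ.∸ 1) ⟩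
    (n ℕ.∸ 1) ℕ.* n              ∎)
  q+2≤n : q ℕ.+ 2 ℕ.≤ n
  q+2≤n = begin
    q ℕ.+ 2                      ≡⟨ ℕ.+-comm q 2 ⟩
    suc (suc q)                  ≤⟨ ℕ.s≤s q<n-1 ⟩
    suc (n ℕ.∸ 1)                ≡⟨ ℕ.suc-pred n ⟩
    n                            ∎

module _ {c ℓ} (F : ArchOrderedField c ℓ) where
  open ArchOrderedField F hiding (zero; _-_; _^_)
  open BetaExpansion F using (T; Tⁱ; FiniteDigits; InFin)
  open RingFormulas rawRing using (_-_; value)
  open import Algebra.Definitions.RawSemiring (RawRing.rawSemiring rawRing) using (_×′_)
  open import Algebra.Properties.Semiring.Exp semiring using (_^_; ^-homo-*)
  open import Algebra.Properties.Monoid.Mult.TCOptimised +-monoid using (1+×)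
  open import Algebra.Properties.Ring ring
    using (-0#≈0#; -‿involutive; -‿+-comm; -‿distribˡ-*; -‿distribʳ-*)
  import Algebra.Solver.Ring.AlmostCommutativeRing as ACR
  module ≈-Reasoning = SetoidReasoning setoid

  ιℕ-+ : ∀ m n → ιℕ (m ℕ.+ n) ≈ ιℕ m + ιℕ n
  ιℕ-+ zero    n = sym (+-identityˡ _)
  ιℕ-+ (suc m) n = trans (+-congˡ (ιℕ-+ m n)) (sym (+-assoc _ _ _))

  ιℕ-* : ∀ m n → ιℕ (m ℕ.* n) ≈ ιℕ m * ιℕ n
  ιℕ-* zero    n = sym (zeroˡ _)
  ιℕ-* (suc m) n = begin
    ιℕ (n ℕ.+ m ℕ.* n)      ≈⟨ ιℕ-+ n (m ℕ.* n) ⟩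
    ιℕ n + ιℕ (m ℕ.* n)     ≈⟨ +-cong (sym (*-identityˡ _)) (ιℕ-* m n) ⟩
    1# * ιℕ n + ιℕ m * ιℕ n ≈⟨ distribʳ _ _ _ ⟨
    (1# + ιℕ m) * ιℕ n      ∎
    where open ≈-Reasoning

  ι-⊖ : ∀ m n → ι (m ℤ.⊖ n) ≈ ιℕ m - ιℕ n
  ι-⊖ m       zero    = sym (trans (+-congˡ -0#≈0#) (+-identityʳ _))
  ι-⊖ zero    (suc n) = sym (+-identityˡ _)
  ι-⊖ (suc m) (suc n) = begin
    ι (suc m ℤ.⊖ suc n)           ≡⟨ ≡.cong ι (ℤ.[1+m]⊖[1+n]≡m⊖n m n) ⟩
    ι (m ℤ.⊖ n)                   ≈⟨ ι-⊖ m n ⟩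
    ιℕ m - ιℕ n                   ≈⟨ +-congʳ (+-identityˡ _) ⟨
    0# + ιℕ m - ιℕ n              ≈⟨ +-congʳ (+-congʳ (-‿inverseʳ 1#)) ⟨
    1# - 1# + ιℕ m - ιℕ n         ≈⟨ +-congʳ (+-assoc _ _ _) ⟩
    1# + (- 1# + ιℕ m) - ιℕ n     ≈⟨ +-congʳ (+-congˡ (+-comm _ _)) ⟩
    1# + (ιℕ m - 1#) - ιℕ n       ≈⟨ +-congʳ (+-assoc _ _ _) ⟨
    1# + ιℕ m - 1# - ιℕ n         ≈⟨ +-assoc _ _ _ ⟩
    1# + ιℕ m + (- 1# - ιℕ n)     ≈⟨ +-congˡ (-‿+-comm 1# (ιℕ n)) ⟩
    (1# + ιℕ m) - (1# + ιℕ n)     ∎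
    where open ≈-Reasoning

  ι-neg : ∀ i → ι (ℤ.- i) ≈ - ι i
  ι-neg (+ zero)  = sym -0#≈0#
  ι-neg (+ suc m) = refl
  ι-neg -[1+ m ]  = sym (-‿involutive _)

  ι-+ : ∀ i j → ι (i ℤ.+ j) ≈ ι i + ι j
  ι-+ (+ m)    (+ n)    = ιℕ-+ m n
  ι-+ (+ m)    -[1+ n ] = ι-⊖ m (suc n)
  ι-+ -[1+ m ] (+ n)    = trans (ι-⊖ n (suc m)) (+-comm _ _)
  ι-+ -[1+ m ] -[1+ n ] = begin
    - ιℕ (suc (suc (m ℕ.+ n)))    ≡⟨ ≡.cong (λ k → - ιℕ (suc k)) (ℕ.+-suc m n) ⟨
    - ιℕ (suc m ℕ.+ suc n)        ≈⟨ -‿cong (ιℕ-+ (suc m) (suc n)) ⟩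
    - (ιℕ (suc m) + ιℕ (suc n))   ≈⟨ -‿+-comm _ _ ⟨
    - ιℕ (suc m) - ιℕ (suc n)     ∎
    where open ≈-Reasoning

  ι-*-+ : ∀ m n → ι (+ m ℤ.* + n) ≈ ιℕ m * ιℕ n
  ι-*-+ m n = trans (reflexive (≡.cong ι (≡.sym (ℤ.pos-* m n)))) (ιℕ-* m n)

  ι-* : ∀ i j → ι (i ℤ.* j) ≈ ι i * ι j
  ι-* (+ m)    (+ n)    = ι-*-+ m n
  ι-* (+ m)    -[1+ n ] = begin
    ι (+ m ℤ.* -[1+ n ])          ≡⟨ ≡.cong ι (ℤ.neg-distribʳ-* (+ m) (+ suc n)) ⟨
    ι (ℤ.- (+ m ℤ.* + suc n))     ≈⟨ ι-neg (+ m ℤ.* + suc n) ⟩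
    - ι (+ m ℤ.* + suc n)         ≈⟨ -‿cong (ι-*-+ m (suc n)) ⟩
    - (ιℕ m * ιℕ (suc n))         ≈⟨ -‿distribʳ-* _ _ ⟩
    ιℕ m * - ιℕ (suc n)           ∎
    where open ≈-Reasoning
  ι-* -[1+ m ] (+ n)    = begin
    ι (-[1+ m ] ℤ.* + n)          ≡⟨ ≡.cong ι (ℤ.neg-distribˡ-* (+ suc m) (+ n)) ⟨
    ι (ℤ.- (+ suc m ℤ.* + n))     ≈⟨ ι-neg (+ suc m ℤ.* + n) ⟩
    - ι (+ suc m ℤ.* + n)         ≈⟨ -‿cong (ι-*-+ (suc m) n) ⟩
    - (ιℕ (suc m) * ιℕ n)         ≈⟨ -‿distribˡ-* _ _ ⟩
    - ιℕ (suc m) * ιℕ n           ∎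
    where open ≈-Reasoning
  ι-* -[1+ m ] -[1+ n ] = begin
    ι (+ suc m ℤ.* + suc n)       ≈⟨ ι-*-+ (suc m) (suc n) ⟩
    ιℕ (suc m) * ιℕ (suc n)       ≈⟨ -‿involutive _ ⟨
    - - (ιℕ (suc m) * ιℕ (suc n)) ≈⟨ -‿cong (-‿distribˡ-* _ _) ⟩
    - (- ιℕ (suc m) * ιℕ (suc n)) ≈⟨ -‿distribʳ-* _ _ ⟩
    - ιℕ (suc m) * - ιℕ (suc n)   ∎
    where open ≈-Reasoning

  -- The coefficient map of the ring solver: equal to ι up to ≈, but sending 1 to 1# and 2 to
  -- 1# + 1# on the nose, so that solver constants match the literals of RingFormulas.
  ιᶻ : ℤ → Carrier
  ιᶻ (+ m)    = m ×′ 1#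
  ιᶻ -[1+ m ] = - (suc m ×′ 1#)

  ιℕ≈ιᶻ : ∀ m → ιℕ m ≈ ιᶻ (+ m)
  ιℕ≈ιᶻ zero    = refl
  ιℕ≈ιᶻ (suc m) = trans (+-congˡ (ιℕ≈ιᶻ m)) (sym (1+× m 1#))

  ιᶻ≈ι : ∀ i → ιᶻ i ≈ ι i
  ιᶻ≈ι (+ m)    = sym (ιℕ≈ιᶻ m)
  ιᶻ≈ι -[1+ m ] = -‿cong (sym (ιℕ≈ιᶻ (suc m)))

  ιᶻ-morphism : ℤ.+-*-rawRing ACR.-Raw-AlmostCommutative⟶ ACR.fromCommutativeRing commRing
  ιᶻ-morphism = record
    { ⟦_⟧    = ιᶻ
    ; +-homo = λ i j → via (i ℤ.+ j) (ι-+ i j) (+-cong (ιᶻ≈ι i) (ιᶻ≈ι j))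
    ; *-homo = λ i j → via (i ℤ.* j) (ι-* i j) (*-cong (ιᶻ≈ι i) (ιᶻ≈ι j))
    ; -‿homo = λ i → via (ℤ.- i) (ι-neg i) (-‿cong (ιᶻ≈ι i))
    ; 0-homo = refl
    ; 1-homo = refl
    }
    where
    via : ∀ i {x y} → ι i ≈ x → y ≈ x → ιᶻ i ≈ y
    via i p q = trans (ιᶻ≈ι i) (trans p (sym q))

  ιᶻ-≟ : ∀ i j → Maybe (ιᶻ i ≈ ιᶻ j)
  ιᶻ-≟ i j with i ℤ.≟ j
  ... | yes ≡.refl = just refl
  ... | no _       = nothing

  open import Algebra.Solver.Ring ℤ.+-*-rawRing (ACR.fromCommutativeRing commRing) ιᶻ-morphism ιᶻ-≟
    using (Polynomial; con; _:+_; _:-_; _:*_; :-_; _:^_; _:×_; _:=_; solve)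

  polynomialRing : ℕ → RawRing _ _
  polynomialRing k = record
    { Carrier = Polynomial k ; _≈_ = _≡_
    ; _+_ = _:+_ ; _*_ = _:*_ ; -_ = :-_ ; 0# = con (+ 0) ; 1# = con (+ 1)
    }

  module Syn {k} = RingFormulas (polynomialRing k)

  ⟦_⟧ᶠ : ℕExpr ℕ → Carrier
  ⟦ # c     ⟧ᶠ = ιᶻ (+ c)
  ⟦ ⟨ x ⟩   ⟧ᶠ = ιℕ x
  ⟦ e ⊕ e′ ⟧ᶠ = ⟦ e ⟧ᶠ + ⟦ e′ ⟧ᶠ
  ⟦ e ⊛ e′ ⟧ᶠ = ⟦ e ⟧ᶠ * ⟦ e′ ⟧ᶠ

  ⌜_⌝ : ∀ {k} → ℕExpr (Polynomial k) → Polynomial k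
  ⌜ # c     ⌝ = con (+ c)
  ⌜ ⟨ x ⟩   ⌝ = x
  ⌜ e ⊕ e′ ⌝ = ⌜ e ⌝ :+ ⌜ e′ ⌝
  ⌜ e ⊛ e′ ⌝ = ⌜ e ⌝ :* ⌜ e′ ⌝

  ιℕ-⟦⟧ : ∀ e → ιℕ ⟦ e ⟧ℕ ≈ ⟦ e ⟧ᶠ
  ιℕ-⟦⟧ (# c)     = ιℕ≈ιᶻ c
  ιℕ-⟦⟧ ⟨ x ⟩     = refl
  ιℕ-⟦⟧ (e ⊕ e′) = trans (ιℕ-+ ⟦ e ⟧ℕ ⟦ e′ ⟧ℕ) (+-cong (ιℕ-⟦⟧ e) (ιℕ-⟦⟧ e′))
  ιℕ-⟦⟧ (e ⊛ e′) = trans (ιℕ-* ⟦ e ⟧ℕ ⟦ e′ ⟧ℕ) (*-cong (ιℕ-⟦⟧ e) (ιℕ-⟦⟧ e′))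

  infixl 6 _+₀_

  _+₀_ : ∀ {x y} → x ≈ 0# → y ≈ 0# → x + y ≈ 0#
  p +₀ q = trans (+-cong p q) (+-identityʳ 0#)

  *₀ : ∀ {c x} → x ≈ 0# → c * x ≈ 0#
  *₀ p = trans (*-congˡ p) (zeroʳ _)

  relation≈0 : ∀ e {x} → ⟦ e ⟧ℕ ≡ x → ιℕ x - ⟦ e ⟧ᶠ ≈ 0#
  relation≈0 e ≡.refl = trans (+-congʳ (ιℕ-⟦⟧ e)) (-‿inverseʳ _)

  ≈-by-identity : ∀ {x y E} → x ≈ y + E → E ≈ 0# → x ≈ y
  ≈-by-identity x≈y+E E≈0 = trans x≈y+E (trans (+-congˡ E≈0) (+-identityʳ _))

  strictTotalOrder : StrictTotalOrder c ℓ ℓ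
  strictTotalOrder = record { isStrictTotalOrder = isStrictTotalOrder }

  open StrictTotalOrder strictTotalOrder
    using (compare; irrefl; <-resp-≈; <-respʳ-≈; <-respˡ-≈; strictPartialOrder)
    renaming (trans to <-trans)
  module <-Reasoning = StrictReasoning strictPartialOrder

  ≤-trans : ∀ {x y z} → x ≤ y → y ≤ z → x ≤ z
  ≤-trans = NonStrict.trans _≈_ _<_ isEquivalence <-resp-≈ <-trans

  <-≤-trans : ∀ {x y z} → x < y → y ≤ z → x < z
  <-≤-trans = NonStrict.<-≤-trans _≈_ _<_ <-trans <-respʳ-≈

  ≤-<-trans : ∀ {x y z} → x ≤ y → y < z → x < z
  ≤-<-trans = NonStrict.≤-<-trans _≈_ _<_ sym <-trans <-respˡ-≈

  <⇒≱ : ∀ {x y} → x < y → ¬ (y ≤ x)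
  <⇒≱ x<y (inj₁ y<x) = irrefl refl (<-trans x<y y<x)
  <⇒≱ x<y (inj₂ y≈x) = irrefl (sym y≈x) x<y

  <-or-≥ : ∀ x y → x < y ⊎ y ≤ x
  <-or-≥ x y with compare x y
  ... | tri< x<y _ _ = inj₁ x<y
  ... | tri≈ _ x≈y _ = inj₂ (inj₂ (sym x≈y))
  ... | tri> _ _ y<x = inj₂ (inj₁ y<x)

  +-monoʳ-< : ∀ z {x y} → x < y → (z + x) < (z + y)
  +-monoʳ-< z x<y = <-respʳ-≈ (+-comm _ _) (<-respˡ-≈ (+-comm _ _) (+-mono-< z x<y))

  +-monoˡ-≤ : ∀ z {x y} → x ≤ y → x + z ≤ y + z
  +-monoˡ-≤ z (inj₁ x<y) = inj₁ (+-mono-< z x<y)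
  +-monoˡ-≤ z (inj₂ x≈y) = inj₂ (+-congʳ x≈y)

  +-monoʳ-≤ : ∀ z {x y} → x ≤ y → z + x ≤ z + y
  +-monoʳ-≤ z (inj₁ x<y) = inj₁ (+-monoʳ-< z x<y)
  +-monoʳ-≤ z (inj₂ x≈y) = inj₂ (+-congˡ x≈y)

  +-mono-≤ : ∀ {x y u v} → x ≤ y → u ≤ v → x + u ≤ y + v
  +-mono-≤ {y = y} {u} x≤y u≤v = ≤-trans (+-monoˡ-≤ u x≤y) (+-monoʳ-≤ y u≤v)

  +-mono-<-≤ : ∀ {x y u v} → x < y → u ≤ v → (x + u) < (y + v)
  +-mono-<-≤ {y = y} {u} x<y u≤v = <-≤-trans (+-mono-< u x<y) (+-monoʳ-≤ y u≤v)

  <⇒0<- : ∀ {x y} → x < y → 0# < (y - x)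
  <⇒0<- {x} x<y = <-respˡ-≈ (-‿inverseʳ x) (+-mono-< (- x) x<y)

  x+[y-x]≈y : ∀ x y → x + (y - x) ≈ y
  x+[y-x]≈y = solve 2 (λ x y → x :+ (y :- x) := y) refl

  0<-⇒< : ∀ {x y} → 0# < (y - x) → x < y
  0<-⇒< {x} {y} 0<y-x = <-respˡ-≈ (+-identityʳ x) (<-respʳ-≈ (x+[y-x]≈y x y) (+-monoʳ-< x 0<y-x))

  ≤⇒0≤- : ∀ {x y} → x ≤ y → 0# ≤ y - x
  ≤⇒0≤- (inj₁ x<y)     = inj₁ (<⇒0<- x<y)
  ≤⇒0≤- {x} (inj₂ x≈y) = inj₂ (sym (trans (+-congʳ (sym x≈y)) (-‿inverseʳ x)))

  0≤-⇒≤ : ∀ {x y} → 0# ≤ y - x → x ≤ y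
  0≤-⇒≤ (inj₁ 0<y-x)         = inj₁ (0<-⇒< 0<y-x)
  0≤-⇒≤ {x} {y} (inj₂ 0≈y-x) = inj₂ (trans (sym (+-identityʳ x)) (trans (+-congˡ 0≈y-x) (x+[y-x]≈y x y)))

  -1<0 : (- 1#) < 0#
  -1<0 = <-respʳ-≈ (-‿inverseʳ 1#) (<-respˡ-≈ (+-identityˡ _) (+-mono-< (- 1#) 0<1))

  x-1<x : ∀ x → (x - 1#) < x
  x-1<x x = <-respʳ-≈ (+-identityʳ x) (+-monoʳ-< x -1<0)

  0≤*0≤ : ∀ {x y} → 0# ≤ x → 0# ≤ y → 0# ≤ x * y
  0≤*0≤ (inj₁ 0<x) (inj₁ 0<y) = inj₁ (*-pos 0<x 0<y)
  0≤*0≤ (inj₂ 0≈x) _          = inj₂ (sym (trans (*-congʳ (sym 0≈x)) (zeroˡ _)))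
  0≤*0≤ _          (inj₂ 0≈y) = inj₂ (sym (trans (*-congˡ (sym 0≈y)) (zeroʳ _)))

  *-difference : ∀ x y c → (y - x) * c ≈ y * c - x * c
  *-difference = solve 3 (λ x y c → (y :- x) :* c := y :* c :- x :* c) refl

  *-monoʳ-< : ∀ {c x y} → 0# < c → x < y → (x * c) < (y * c)
  *-monoʳ-< {c} {x} {y} 0<c x<y = 0<-⇒< (<-respʳ-≈ (*-difference x y c) (*-pos (<⇒0<- x<y) 0<c))

  *-monoʳ-≤ : ∀ {c x y} → 0# ≤ c → x ≤ y → x * c ≤ y * c
  *-monoʳ-≤ {c} {x} {y} 0≤c x≤y = 0≤-⇒≤ (≤-trans (0≤*0≤ (≤⇒0≤- x≤y) 0≤c) (inj₂ (*-difference x y c)))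

  *-monoˡ-< : ∀ {c x y} → 0# < c → x < y → (c * x) < (c * y)
  *-monoˡ-< 0<c x<y = <-respˡ-≈ (*-comm _ _) (<-respʳ-≈ (*-comm _ _) (*-monoʳ-< 0<c x<y))

  *-monoˡ-≤ : ∀ {c x y} → 0# ≤ c → x ≤ y → c * x ≤ c * y
  *-monoˡ-≤ 0≤c x≤y =
    ≤-trans (inj₂ (*-comm _ _)) (≤-trans (*-monoʳ-≤ 0≤c x≤y) (inj₂ (*-comm _ _)))

  *-mono-≤ : ∀ {x y u v} → 0# ≤ x → 0# ≤ u → x ≤ y → u ≤ v → x * u ≤ y * v
  *-mono-≤ 0≤x 0≤u x≤y u≤v = ≤-trans (*-monoʳ-≤ 0≤u x≤y) (*-monoˡ-≤ (≤-trans 0≤x x≤y) u≤v)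

  *-cancelˡ-< : ∀ {c x y} → 0# < c → (c * x) < (c * y) → x < y
  *-cancelˡ-< {x = x} {y} 0<c cx<cy with <-or-≥ x y
  ... | inj₁ x<y = x<y
  ... | inj₂ y≤x = ⊥-elim (<⇒≱ cx<cy (*-monoˡ-≤ (inj₁ 0<c) y≤x))

  *-cancelˡ-≤ : ∀ {c x y} → 0# < c → c * x ≤ c * y → x ≤ y
  *-cancelˡ-≤ {x = x} {y} 0<c cx≤cy with <-or-≥ y x
  ... | inj₁ y<x = ⊥-elim (<⇒≱ (*-monoˡ-< 0<c y<x) cx≤cy)
  ... | inj₂ x≤y = x≤y

  0≤ιℕ : ∀ m → 0# ≤ ιℕ m
  0≤ιℕ zero    = inj₂ refl
  0≤ιℕ (suc m) = ≤-trans (inj₂ (sym (+-identityʳ 0#))) (+-mono-≤ (inj₁ 0<1) (0≤ιℕ m))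

  0<ιℕ : ∀ {m} → 0 ℕ.< m → 0# < ιℕ m
  0<ιℕ {suc m} _ = <-respˡ-≈ (+-identityʳ 0#) (+-mono-<-≤ 0<1 (0≤ιℕ m))

  ιℕ-mono-≤ : ∀ {m m′} → m ℕ.≤ m′ → ιℕ m ≤ ιℕ m′
  ιℕ-mono-≤ {zero} {m′} _ = 0≤ιℕ m′
  ιℕ-mono-≤ (ℕ.s≤s m≤m′)  = +-monoʳ-≤ 1# (ιℕ-mono-≤ m≤m′)

  ιℕ-suc-≤ : ∀ {m m′} → m ℕ.< m′ → ιℕ m + 1# ≤ ιℕ m′
  ιℕ-suc-≤ m<m′ = ≤-trans (inj₂ (+-comm _ _)) (ιℕ-mono-≤ m<m′)

  1<ιℕ : ∀ {k} → 2 ℕ.≤ k → 1# < ιℕ k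
  1<ιℕ 2≤k = <-≤-trans (<-respˡ-≈ (+-identityʳ 1#) (+-monoʳ-< 1# (0<ιℕ {1} (ℕ.s≤s ℕ.z≤n)))) (ιℕ-mono-≤ 2≤k)

  x<x+1 : ∀ x → x < (x + 1#)
  x<x+1 x = <-respˡ-≈ (+-identityʳ x) (+-monoʳ-< x 0<1)

  ι-negative+1≤0 : ∀ m → ι -[1+ m ] + 1# ≤ 0#
  ι-negative+1≤0 m =
    0≤-⇒≤ (≤-trans (0≤ιℕ m) (inj₂ (solve 1 (λ x → x := con (+ 0) :- (:- (con (+ 1) :+ x) :+ con (+ 1))) refl (ιℕ m))))

  ⌊⌋-unique : ∀ {x} d → ιℕ d ≤ x → x < (ιℕ d + 1#) → ⌊ x ⌋ ≡ + d
  ⌊⌋-unique {x} d d≤x x<d+1 with ⌊ x ⌋ | ⌊⌋-lower x | ⌊⌋-upper x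
  ... | -[1+ m ] | _ | x<⌊x⌋+1 =
    ⊥-elim (<⇒≱ (<-≤-trans x<⌊x⌋+1 (ι-negative+1≤0 m)) (≤-trans (0≤ιℕ d) d≤x))
  ... | + m | m≤x | x<m+1 with ℕ.<-cmp m d
  ...   | tri< m<d _ _ = ⊥-elim (<⇒≱ x<m+1 (≤-trans (ιℕ-suc-≤ m<d) d≤x))
  ...   | tri≈ _ m≡d _ = ≡.cong +_ m≡d
  ...   | tri> _ _ d<m = ⊥-elim (<⇒≱ x<d+1 (≤-trans (ιℕ-suc-≤ d<m) m≤x))

  module Expansions (β : Carrier) where

    val : List ℕ → Carrier
    val []      = 0#
    val (d ∷ w) = ιℕ d * β ^ length w + val w

    infix 4 _⟨_⟩⇝_
    record _⟨_⟩⇝_ (P : Carrier) (w : List ℕ) (P′ : Carrier) : Set ℓ where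
      constructor mk⇝
      field equation : β ^ length w * P ≈ val w + P′
    open _⟨_⟩⇝_ public

    val-⟦⟧ : ∀ ds → val (List.map ⟦_⟧ℕ ds) ≈ value β (List.map ⟦_⟧ᶠ ds)
    val-⟦⟧ []       = refl
    val-⟦⟧ (d ∷ ds) = +-cong (*-cong (ιℕ-⟦⟧ d) (reflexive (≡.cong (β ^_) same-length))) (val-⟦⟧ ds)
      where
      same-length : length (List.map ⟦_⟧ℕ ds) ≡ length (List.map ⟦_⟧ᶠ ds)
      same-length = ≡.trans (List.length-map ⟦_⟧ℕ ds) (≡.sym (List.length-map ⟦_⟧ᶠ ds))

    ⇝-by-identity : ∀ ds {P P′ E} → β ^ length ds * P ≈ value β (List.map ⟦_⟧ᶠ ds) + P′ + E →
                    E ≈ 0# → P ⟨ List.map ⟦_⟧ℕ ds ⟩⇝ P′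
    ⇝-by-identity ds {P} {P′} eq E≈0 = mk⇝ (begin
      β ^ length (List.map ⟦_⟧ℕ ds) * P    ≡⟨ ≡.cong (λ k → β ^ k * P) (List.length-map ⟦_⟧ℕ ds) ⟩
      β ^ length ds * P                   ≈⟨ ≈-by-identity eq E≈0 ⟩
      value β (List.map ⟦_⟧ᶠ ds) + P′      ≈⟨ +-congʳ (val-⟦⟧ ds) ⟨
      val (List.map ⟦_⟧ℕ ds) + P′          ∎)
      where open ≈-Reasoning

    ⇝-[] : ∀ {P P′} → P ≈ P′ → P ⟨ [] ⟩⇝ P′
    ⇝-[] P≈P′ = mk⇝ (trans (*-identityˡ _) (trans P≈P′ (sym (+-identityˡ _))))

    ⇝-[]⁻¹ : ∀ {P P′} → P ⟨ [] ⟩⇝ P′ → P ≈ P′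
    ⇝-[]⁻¹ (mk⇝ eq) = trans (sym (*-identityˡ _)) (trans eq (+-identityˡ _))

    β^-++ : ∀ (u v : List ℕ) → β ^ length (u ++ v) ≈ β ^ length v * β ^ length u
    β^-++ u v = begin
      β ^ length (u ++ v)                 ≡⟨ ≡.cong (β ^_) (List.length-++ u) ⟩
      β ^ (length u ℕ.+ length v)         ≈⟨ ^-homo-* β (length u) (length v) ⟩
      β ^ length u * β ^ length v         ≈⟨ *-comm _ _ ⟩
      β ^ length v * β ^ length u         ∎
      where open ≈-Reasoning

    val-++ : ∀ u v → val (u ++ v) ≈ β ^ length v * val u + val v
    val-++ []      v = sym (trans (+-congʳ (zeroʳ _)) (+-identityˡ _))
    val-++ (d ∷ u) v = begin
      ιℕ d * β ^ length (u ++ v) + val (u ++ v)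
        ≈⟨ +-cong (*-congˡ (β^-++ u v)) (val-++ u v) ⟩
      ιℕ d * (β ^ length v * β ^ length u) + (β ^ length v * val u + val v)
        ≈⟨ solve 5 (λ d v u x y → d :* (v :* u) :+ (v :* x :+ y) := v :* (d :* u :+ x) :+ y) refl _ _ _ _ _ ⟩
      β ^ length v * (ιℕ d * β ^ length u + val u) + val v ∎
      where open ≈-Reasoning

    ⇝-++ : ∀ {u v P P′ P″} → P ⟨ u ⟩⇝ P′ → P′ ⟨ v ⟩⇝ P″ → P ⟨ u ++ v ⟩⇝ P″
    ⇝-++ {u} {v} {P} {P′} {P″} (mk⇝ P⇝P′) (mk⇝ P′⇝P″) = mk⇝ (begin
      β ^ length (u ++ v) * P                       ≈⟨ *-congʳ (β^-++ u v) ⟩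
      β ^ length v * β ^ length u * P               ≈⟨ *-assoc _ _ _ ⟩
      β ^ length v * (β ^ length u * P)             ≈⟨ *-congˡ P⇝P′ ⟩
      β ^ length v * (val u + P′)                   ≈⟨ distribˡ _ _ _ ⟩
      β ^ length v * val u + β ^ length v * P′      ≈⟨ +-congˡ P′⇝P″ ⟩
      β ^ length v * val u + (val v + P″)           ≈⟨ +-assoc _ _ _ ⟨
      β ^ length v * val u + val v + P″             ≈⟨ +-congʳ (val-++ u v) ⟨
      val (u ++ v) + P″                             ∎)
      where open ≈-Reasoning

    ⇝-uncons : ∀ {d w P P′} → P ⟨ d ∷ w ⟩⇝ P′ → β * P - ιℕ d ⟨ w ⟩⇝ P′
    ⇝-uncons {d} {w} {P} {P′} (mk⇝ P⇝P′) = mk⇝ (begin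
      β ^ length w * (β * P - ιℕ d)
        ≈⟨ solve 4 (λ b B P d → B :* (b :* P :- d) := b :* B :* P :- d :* B) refl β _ P _ ⟩
      β * β ^ length w * P - ιℕ d * β ^ length w
        ≈⟨ +-congʳ P⇝P′ ⟩
      ιℕ d * β ^ length w + val w + P′ - ιℕ d * β ^ length w
        ≈⟨ solve 3 (λ x v p → x :+ v :+ p :- x := v :+ p) refl _ _ _ ⟩
      val w + P′                                    ∎)
      where open ≈-Reasoning

    Tⁱ-suc : ∀ j y → Tⁱ β (suc j) y ≡ Tⁱ β j (T β y)
    Tⁱ-suc zero    y = ≡.refl
    Tⁱ-suc (suc j) y = ≡.cong (T β) (Tⁱ-suc j y)

    finiteDigits-step : ∀ {y} d → ⌊ β * y ⌋ ≡ + d → FiniteDigits β (β * y - ιℕ d) → FiniteDigits β y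
    finiteDigits-step {y} d ⌊βy⌋≡d (M , later-zero) = suc M , shifted
      where
      shifted : ∀ j → suc M ℕ.≤ j → ⌊ β * Tⁱ β j y ⌋ ≡ + 0
      shifted (suc j) (ℕ.s≤s M≤j) = begin
        ⌊ β * Tⁱ β (suc j) y ⌋                   ≡⟨ ≡.cong (λ t → ⌊ β * t ⌋) (Tⁱ-suc j y) ⟩
        ⌊ β * Tⁱ β j (β * y - ι ⌊ β * y ⌋) ⌋      ≡⟨ ≡.cong (λ i → ⌊ β * Tⁱ β j (β * y - ι i) ⌋) ⌊βy⌋≡d ⟩
        ⌊ β * Tⁱ β j (β * y - ιℕ d) ⌋            ≡⟨ later-zero j M≤j ⟩
        + 0                                      ∎
        where open ≡.≡-Reasoning

    finiteDigits-zero : ∀ {y} → y ≈ 0# → FiniteDigits β y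
    finiteDigits-zero {y} y≈0 = 0 , λ j _ → ⌊β*0⌋ (Tⁱ≈0 j)
      where
      ⌊β*0⌋ : ∀ {x} → x ≈ 0# → ⌊ β * x ⌋ ≡ + 0
      ⌊β*0⌋ {x} x≈0 = ⌊⌋-unique 0 (inj₂ (sym βx≈0)) (<-respˡ-≈ (sym βx≈0) (x<x+1 0#))
        where
        βx≈0 : β * x ≈ 0#
        βx≈0 = trans (*-congˡ x≈0) (zeroʳ β)
      Tⁱ≈0 : ∀ j → Tⁱ β j y ≈ 0#
      Tⁱ≈0 zero    = y≈0
      Tⁱ≈0 (suc j) rewrite ⌊β*0⌋ (Tⁱ≈0 j) =
        trans (+-cong (trans (*-congˡ (Tⁱ≈0 j)) (zeroʳ β)) -0#≈0#) (+-identityʳ 0#)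

  module Admissibility (n : ℕ) (0<n : 0 ℕ.< n) (β : Carrier)
                       (n≤β : ιℕ n ≤ β) (nβ+1≤β² : ιℕ n * β + 1# ≤ β * β) where
    open Expansions β

    data Admissible : List ℕ → Set where
      []   : Admissible []
      _∷_  : ∀ {d w} → d ℕ.< n → Admissible w → Admissible (d ∷ w)
      n0∷_ : ∀ {w} → Admissible w → Admissible (n ∷ 0 ∷ w)

    Admissible-tail : ∀ {d w} → Admissible (d ∷ w) → Admissible w
    Admissible-tail (_ ∷ adm) = adm
    Admissible-tail (n0∷ adm) = 0<n ∷ adm

    Admissible-++ : ∀ {u v} → All (ℕ._< n) u → Admissible v → Admissible (u ++ v)
    Admissible-++ All.[]            adm = adm
    Admissible-++ (d<n All.∷ u<n) adm = d<n ∷ Admissible-++ u<n adm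

    0<β : 0# < β
    0<β = <-≤-trans (0<ιℕ 0<n) n≤β

    0≤β^ : ∀ k → 0# ≤ β ^ k
    0≤β^ zero    = inj₁ 0<1
    0≤β^ (suc k) = 0≤*0≤ (inj₁ 0<β) (0≤β^ k)

    0<β^ : ∀ k → 0# < (β ^ k)
    0<β^ zero    = 0<1
    0<β^ (suc k) = *-pos 0<β (0<β^ k)

    0≤val : ∀ w → 0# ≤ val w
    0≤val []      = inj₂ refl
    0≤val (d ∷ w) =
      ≤-trans (inj₂ (sym (+-identityʳ 0#))) (+-mono-≤ (0≤*0≤ (0≤ιℕ d) (0≤β^ (length w))) (0≤val w))

    val<β^length : ∀ {w} → Admissible w → val w < (β ^ length w)
    val<β^length []                     = 0<1
    val<β^length (_∷_ {d} {w} d<n adm) = begin-strict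
      ιℕ d * B + val w          <⟨ +-monoʳ-< _ (val<β^length adm) ⟩
      ιℕ d * B + B              ≈⟨ solve 2 (λ d B → d :* B :+ B := (d :+ con (+ 1)) :* B) refl _ _ ⟩
      (ιℕ d + 1#) * B           ≤⟨ *-monoʳ-≤ (0≤β^ (length w)) (ιℕ-suc-≤ d<n) ⟩
      ιℕ n * B                  ≤⟨ *-monoʳ-≤ (0≤β^ (length w)) n≤β ⟩
      β * B                     ∎
      where
      open <-Reasoning
      B : Carrier
      B = β ^ length w
    val<β^length (n0∷_ {w} adm) = begin-strict
      ιℕ n * (β * B) + (0# * B + val w)   <⟨ +-monoʳ-< _ (+-monoʳ-< _ (val<β^length adm)) ⟩
      ιℕ n * (β * B) + (0# * B + B)
        ≈⟨ solve 3 (λ N b B → N :* (b :* B) :+ (con (+ 0) :* B :+ B) := (N :* b :+ con (+ 1)) :* B) refl _ _ _ ⟩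
      (ιℕ n * β + 1#) * B                 ≤⟨ *-monoʳ-≤ (0≤β^ (length w)) nβ+1≤β² ⟩
      β * β * B                           ≈⟨ *-assoc _ _ _ ⟩
      β * (β * B)                         ∎
      where
      open <-Reasoning
      B : Carrier
      B = β ^ length w

    ⌊⌋-leading : ∀ {d w y} → Admissible w → y ⟨ d ∷ w ⟩⇝ 0# → ⌊ β * y ⌋ ≡ + d
    ⌊⌋-leading {d} {w} {y} adm y⇝0 = ⌊⌋-unique d (0≤-⇒≤ 0≤y′) (0<-⇒< y′<1′)
      where
      y′ B : Carrier
      y′ = β * y - ιℕ d
      B  = β ^ length w
      By′≈val : B * y′ ≈ val w
      By′≈val = trans (equation (⇝-uncons y⇝0)) (+-identityʳ _)
      0≤y′ : 0# ≤ y′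
      0≤y′ = *-cancelˡ-≤ (0<β^ (length w)) (≤-trans (inj₂ (zeroʳ B)) (≤-trans (0≤val w) (inj₂ (sym By′≈val))))
      y′<1 : y′ < 1#
      y′<1 = *-cancelˡ-< (0<β^ (length w))
               (<-respˡ-≈ (sym By′≈val) (<-respʳ-≈ (sym (*-identityʳ B)) (val<β^length adm)))
      y′<1′ : 0# < (ιℕ d + 1# - β * y)
      y′<1′ = <-respʳ-≈ (solve 2 (λ d y → con (+ 1) :- (y :- d) := d :+ con (+ 1) :- y) refl (ιℕ d) (β * y))
                        (<⇒0<- y′<1)

    finiteDigits : ∀ {d w y} → Admissible w → y ⟨ d ∷ w ⟩⇝ 0# → FiniteDigits β y
    finiteDigits {d} {[]}     adm y⇝0 =
      finiteDigits-step d (⌊⌋-leading adm y⇝0) (finiteDigits-zero (⇝-[]⁻¹ (⇝-uncons y⇝0)))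
    finiteDigits {d} {_ ∷ _} adm y⇝0 =
      finiteDigits-step d (⌊⌋-leading adm y⇝0) (finiteDigits (Admissible-tail adm) (⇝-uncons y⇝0))

    Expansion : Carrier → Set ℓ
    Expansion P = Σ[ w ∈ List ℕ ] Admissible w × P ⟨ w ⟩⇝ 0#

    infix 4 _↝_
    _↝_ : Carrier → Carrier → Set ℓ
    P ↝ P′ = Σ[ w ∈ List ℕ ] All (ℕ._< n) w × P ⟨ w ⟩⇝ P′

    ↝-reflexive : ∀ {P P′} → P ≈ P′ → P ↝ P′
    ↝-reflexive P≈P′ = [] , All.[] , ⇝-[] P≈P′

    ↝-trans : ∀ {P P′ P″} → P ↝ P′ → P′ ↝ P″ → P ↝ P″
    ↝-trans (u , u<n , P⇝P′) (v , v<n , P′⇝P″) = u ++ v , All.++⁺ u<n v<n , ⇝-++ P⇝P′ P′⇝P″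

    ↝-expansion : ∀ {P P′} → P ↝ P′ → Expansion P′ → Expansion P
    ↝-expansion (u , u<n , P⇝P′) (w , adm , P′⇝0) = u ++ w , Admissible-++ u<n adm , ⇝-++ P⇝P′ P′⇝0

    ↝-preorder : Preorder c ℓ ℓ
    ↝-preorder = record
      { _≈_ = _≈_ ; _≲_ = _↝_
      ; isPreorder = record { isEquivalence = isEquivalence ; reflexive = ↝-reflexive ; trans = ↝-trans }
      }

    module ↝-Reasoning = PreorderReasoning ↝-preorder

  -- The root β of p_n

  module _ (n : ℕ) (2≤n : 2 ℕ.≤ n) (β : Carrier) (pβ : BetaExpansion.pₙ F n β ≈ 0#) where
    open RingFormulas.Root rawRing β (ιℕ n)
    private
      N : Carrier
      N = ιℕ n

    cubic≈0 : cubic ≈ 0#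
    cubic≈0 = pβ

    0<n : 0 ℕ.< n
    0<n = ℕ.<-≤-trans (ℕ.s≤s ℕ.z≤n) 2≤n

    0<N : 0# < N
    0<N = 0<ιℕ 0<n

    root-identity : β * ((β - 1#) * (β - N)) ≈ N
    root-identity = ≈-by-identity
      (solve 2 (λ β N → β :* ((β :- con (+ 1)) :* (β :- N)) := N :+ con (+ 1) :* Syn.Root.cubic β N) refl β N)
      (*₀ cubic≈0)

    square-identity : β ^ 2 * (β * (β - N) - 1#) ≈ N
    square-identity = ≈-by-identity
      (solve 2 (λ β N → β :^ 2 :* (β :* (β :- N) :- con (+ 1)) := N :+ (β :+ con (+ 1)) :* Syn.Root.cubic β N)
        refl β N)
      (*₀ cubic≈0)

    n<β : N < β
    n<β with <-or-≥ N β
    ... | inj₁ N<β = N<β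
    ... | inj₂ β≤N with <-or-≥ 0# β
    ...   | inj₁ 0<β = ⊥-elim (<⇒≱ 0<N (≤-trans (inj₂ (sym square-identity)) square≤0))
      where
      β[β-N]≤0 : β * (β - N) ≤ 0#
      β[β-N]≤0 = ≤-trans (*-monoˡ-≤ (inj₁ 0<β) (≤-trans (+-monoˡ-≤ (- N) β≤N) (inj₂ (-‿inverseʳ N))))
                         (inj₂ (zeroʳ β))
      square≤0 : β ^ 2 * (β * (β - N) - 1#) ≤ 0#
      square≤0 = ≤-trans (*-monoˡ-≤ (0≤*0≤ (inj₁ 0<β) (0≤*0≤ (inj₁ 0<β) (inj₁ 0<1)))
                                     (≤-trans (inj₁ (x-1<x _)) β[β-N]≤0))
                         (inj₂ (zeroʳ _))
    ...   | inj₂ β≤0 = ⊥-elim (<⇒≱ 0<N (≤-trans (inj₂ (sym root-identity)) root≤0))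
      where
      0<[β-1][β-N] : 0# < ((β - 1#) * (β - N))
      0<[β-1][β-N] = <-respʳ-≈
        (solve 2 (λ β N → (con (+ 1) :- β) :* (N :- β) := (β :- con (+ 1)) :* (β :- N)) refl β N)
        (*-pos (<⇒0<- (≤-<-trans β≤0 0<1)) (<⇒0<- (≤-<-trans β≤0 0<N)))
      root≤0 : β * ((β - 1#) * (β - N)) ≤ 0#
      root≤0 = ≤-trans (*-monoʳ-≤ (inj₁ 0<[β-1][β-N]) β≤0) (inj₂ (zeroˡ _))

    β<n+1 : β < (N + 1#)
    β<n+1 with <-or-≥ β (N + 1#)
    ... | inj₁ β<N+1 = β<N+1
    ... | inj₂ N+1≤β = ⊥-elim (<⇒≱ N<product (≤-trans product≤root (inj₂ root-identity)))
      where
      0≤N : 0# ≤ N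
      0≤N = 0≤ιℕ n
      N<product : N < ((N + 1#) * (N * 1#))
      N<product = 0<-⇒< (<-respʳ-≈
        (solve 1 (λ N → N :* N := (N :+ con (+ 1)) :* (N :* con (+ 1)) :- N) refl N) (*-pos 0<N 0<N))
      0≤β-[N+1] : 0# ≤ β - (N + 1#)
      0≤β-[N+1] = ≤⇒0≤- N+1≤β
      N≤β-1 : N ≤ β - 1#
      N≤β-1 = 0≤-⇒≤ (≤-trans 0≤β-[N+1]
        (inj₂ (solve 2 (λ β N → β :- (N :+ con (+ 1)) := β :- con (+ 1) :- N) refl β N)))
      1≤β-N : 1# ≤ β - N
      1≤β-N = 0≤-⇒≤ (≤-trans 0≤β-[N+1]
        (inj₂ (solve 2 (λ β N → β :- (N :+ con (+ 1)) := β :- N :- con (+ 1)) refl β N)))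
      product≤root : (N + 1#) * (N * 1#) ≤ β * ((β - 1#) * (β - N))
      product≤root = *-mono-≤ (≤-trans 0≤N (inj₁ (x<x+1 N))) (0≤*0≤ 0≤N (inj₁ 0<1)) N+1≤β
                              (*-mono-≤ 0≤N (inj₁ 0<1) N≤β-1 1≤β-N)

    nβ+1<β² : (N * β + 1#) < (β * β)
    nβ+1<β² = 0<-⇒< (<-respʳ-≈
      (solve 2 (λ β N → β :* (β :- N) :- con (+ 1) := β :* β :- (N :* β :+ con (+ 1))) refl β N)
      (*-cancelˡ-< 0<β² (<-respˡ-≈ (sym (zeroʳ _)) (<-respʳ-≈ (sym square-identity) 0<N))))
      where
      0<β : 0# < β
      0<β = ≤-<-trans (0≤ιℕ n) n<β
      0<β² : 0# < (β ^ 2)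
      0<β² = *-pos 0<β (*-pos 0<β 0<1)

    open Expansions β
    open Admissibility n 0<n β (inj₁ n<β) (inj₁ nβ+1<β²)

    -- Descent from ρ q to ρ (q − 1)

    -- Each block below is certified by a ring identity
    --   β ^ length w * P = value w + P′ + c₀ · p_n(β) + Σ cᵢ · (atomᵢ − its expression),
    -- whose cofactors cᵢ come from dividing by p_n(β) and by the linear relations between atoms.
    module Stage (q u : ℕ) (q+2+u≡n : q ℕ.+ 2 ℕ.+ u ≡ n) where
      private
        Q : Carrier
        Q = ιℕ q

      below : ∀ {e} → e ≡ q → ∀ d k → d ℕ.+ suc k ≡ e ℕ.+ 2 ℕ.+ u → d ℕ.< n
      below ≡.refl d k eq = ℕ.<-≤-trans (ℕ.m<m+n d (ℕ.s≤s ℕ.z≤n)) (ℕ.≤-reflexive (≡.trans eq q+2+u≡n))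

      ρ≈ρᴬ0 : ρ Q ≈ ρᴬ Q (ιℕ 0)
      ρ≈ρᴬ0 = solve 3 (λ β N Q → Syn.Root.ρ β N Q := Syn.Root.ρᴬ β N Q (con (+ 0))) refl β N Q

      ρᴬ≈ρᴮ0 : ∀ {m} → m ℕ.* 2 ≡ q → ρᴬ Q (ιℕ m) ≈ ρᴮ Q (ιℕ 0)
      ρᴬ≈ρᴮ0 {m} q≡ = ≈-by-identity
        (solve 4 (λ β N Q M →
             Syn.Root.ρᴬ β N Q M
          := Syn.Root.ρᴮ β N Q (con (+ 0)) :+ :- Syn.Root.w β N :* (Q :- ⌜ ⟨ M ⟩ ⊛ # 2 ⌝))
          refl β N Q (ιℕ m))
        (*₀ (relation≈0 (⟨ m ⟩ ⊛ # 2) q≡))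

      A-digits : ∀ {x} {X : Set x} → X → X → X → List (ℕExpr X)
      A-digits j a u = ⟨ u ⟩ ⊕ # 1 ∷ ⟨ u ⟩ ⊕ # 3 ⊕ ⟨ j ⟩ ⊛ # 2 ∷ # 2 ⊕ ⟨ j ⟩ ⊛ # 2
                     ∷ ⟨ j ⟩ ⊛ # 2 ⊕ # 3 ⊕ ⟨ a ⟩ ∷ ⟨ a ⟩ ∷ ⟨ a ⟩ ⊕ ⟨ u ⟩ ⊕ # 1 ∷ []

      A-step : ∀ {j a} → suc j ℕ.* 2 ℕ.+ a ≡ q → ρᴬ Q (ιℕ j) ↝ ρᴬ Q (ιℕ (suc j))
      A-step {j} {a} q≡ = _ , digits<n , ⇝-by-identity (A-digits j a u)
        (solve 6 (λ β N Q J A U →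
             β :^ 6 :* Syn.Root.ρᴬ β N Q J
          := Syn.value β (List.map ⌜_⌝ (A-digits J A U)) :+ Syn.Root.ρᴬ β N Q (con (+ 1) :+ J)
             :+ ( ( :- (2 :× J) :* β :^ 5 :- Q :* β :^ 4 :+ (2 :× J :+ con (+ 1) :- Q) :* β :^ 3
                  :+ (2 :× J :+ con (+ 2)) :* β :^ 2 :+ (Q :+ con (+ 1)) :* β :+ Q :- 2 :× J :- con (+ 1))
                  :* Syn.Root.cubic β N
                :+ (β :^ 5 :+ β :^ 4 :+ con (+ 1)) :* (N :- ⌜ ⟨ Q ⟩ ⊕ # 2 ⊕ ⟨ U ⟩ ⌝)
                :+ (β :^ 2 :+ β :+ con (+ 1)) :* (Q :- ⌜ (# 1 ⊕ ⟨ J ⟩) ⊛ # 2 ⊕ ⟨ A ⟩ ⌝)))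
          refl β N Q (ιℕ j) (ιℕ a) (ιℕ u))
        (*₀ cubic≈0 +₀ *₀ (relation≈0 (⟨ q ⟩ ⊕ # 2 ⊕ ⟨ u ⟩) q+2+u≡n)
                    +₀ *₀ (relation≈0 ((# 1 ⊕ ⟨ j ⟩) ⊛ # 2 ⊕ ⟨ a ⟩) q≡))
        where
        digits<n : All (ℕ._< n) (List.map ⟦_⟧ℕ (A-digits j a u))
        digits<n = below q≡ (u ℕ.+ 1)               (j ℕ.* 2 ℕ.+ a ℕ.+ 2) (ℕ-Solver.solve (j ∷ a ∷ u ∷ []))
           All.∷ below q≡ (u ℕ.+ 3 ℕ.+ j ℕ.* 2)     a                     (ℕ-Solver.solve (j ∷ a ∷ u ∷ []))
           All.∷ below q≡ (2 ℕ.+ j ℕ.* 2)           (a ℕ.+ u ℕ.+ 1)       (ℕ-Solver.solve (j ∷ a ∷ u ∷ []))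
           All.∷ below q≡ (j ℕ.* 2 ℕ.+ 3 ℕ.+ a)     u                     (ℕ-Solver.solve (j ∷ a ∷ u ∷ []))
           All.∷ below q≡ a                         (j ℕ.* 2 ℕ.+ u ℕ.+ 3) (ℕ-Solver.solve (j ∷ a ∷ u ∷ []))
           All.∷ below q≡ (a ℕ.+ u ℕ.+ 1)           (j ℕ.* 2 ℕ.+ 2)       (ℕ-Solver.solve (j ∷ a ∷ u ∷ []))
           All.∷ All.[]

      A-run : ∀ c → c ℕ.* 2 ℕ.≤ q → ρᴬ Q (ιℕ 0) ↝ ρᴬ Q (ιℕ c)
      A-run zero    _     = ↝-reflexive refl
      A-run (suc c) c*2≤q with ℕ.m≤n⇒∃[o]m+o≡n c*2≤q
      ... | a , q≡ =
        ↝-trans (A-run c (ℕ.≤-trans (ℕ.*-monoˡ-≤ 2 (ℕ.n≤1+n c)) c*2≤q)) (A-step {c} {a} q≡)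

      B-digits : ∀ {x} {X : Set x} → X → X → X → List (ℕExpr X)
      B-digits j b u = ⟨ u ⟩ ⊕ # 2 ⊕ ⟨ j ⟩ ⊛ # 2 ∷ # 1 ⊕ ⟨ j ⟩ ⊛ # 2 ∷ ⟨ j ⟩ ⊛ # 2 ⊕ # 5 ⊕ ⟨ b ⟩ ⊛ # 2
                     ∷ ⟨ b ⟩ ⊛ # 2 ⊕ # 3 ∷ ⟨ b ⟩ ⊛ # 2 ⊕ # 4 ⊕ ⟨ u ⟩ ∷ ⟨ u ⟩ ⊕ # 1 ∷ []

      B-step : ∀ {j b} → suc (suc (b ℕ.+ j)) ℕ.* 2 ≡ q → ρᴮ Q (ιℕ j) ↝ ρᴮ Q (ιℕ (suc j))
      B-step {j} {b} q≡ = _ , digits<n , ⇝-by-identity (B-digits j b u)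
        (solve 6 (λ β N Q J B U →
             β :^ 6 :* Syn.Root.ρᴮ β N Q J
          := Syn.value β (List.map ⌜_⌝ (B-digits J B U)) :+ Syn.Root.ρᴮ β N Q (con (+ 1) :+ J)
             :+ ( ( :- (2 :× B :+ 2 :× J :+ con (+ 4)) :* β :^ 5 :- (2 :× B :+ con (+ 4)) :* β :^ 4
                  :+ (2 :× J :+ con (+ 1)) :* β :^ 3 :+ (2 :× B :+ 2 :× J :+ con (+ 5)) :* β :^ 2
                  :+ (2 :× B :+ con (+ 4)) :* β :- 2 :× J :- con (+ 1))
                  :* Syn.Root.cubic β N
                :+ (β :^ 5 :+ β :+ con (+ 1)) :* (N :- ⌜ ⟨ Q ⟩ ⊕ # 2 ⊕ ⟨ U ⟩ ⌝)
                :+ (β :^ 6 :+ β :^ 5 :+ β :^ 2 :+ β :- (β :- N) :* β :^ 7 :- N :* β)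
                   :* (Q :- ⌜ (# 2 ⊕ ⟨ B ⟩ ⊕ ⟨ J ⟩) ⊛ # 2 ⌝)))
          refl β N Q (ιℕ j) (ιℕ b) (ιℕ u))
        (*₀ cubic≈0 +₀ *₀ (relation≈0 (⟨ q ⟩ ⊕ # 2 ⊕ ⟨ u ⟩) q+2+u≡n)
                    +₀ *₀ (relation≈0 ((# 2 ⊕ ⟨ b ⟩ ⊕ ⟨ j ⟩) ⊛ # 2) q≡))
        where
        digits<n : All (ℕ._< n) (List.map ⟦_⟧ℕ (B-digits j b u))
        digits<n = below q≡ (u ℕ.+ 2 ℕ.+ j ℕ.* 2)     (b ℕ.* 2 ℕ.+ 3)             (ℕ-Solver.solve (j ∷ b ∷ u ∷ []))
           All.∷ below q≡ (1 ℕ.+ j ℕ.* 2)             (b ℕ.* 2 ℕ.+ 4 ℕ.+ u)       (ℕ-Solver.solve (j ∷ b ∷ u ∷ []))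
           All.∷ below q≡ (j ℕ.* 2 ℕ.+ 5 ℕ.+ b ℕ.* 2) u                           (ℕ-Solver.solve (j ∷ b ∷ u ∷ []))
           All.∷ below q≡ (b ℕ.* 2 ℕ.+ 3)             (j ℕ.* 2 ℕ.+ 2 ℕ.+ u)       (ℕ-Solver.solve (j ∷ b ∷ u ∷ []))
           All.∷ below q≡ (b ℕ.* 2 ℕ.+ 4 ℕ.+ u)       (j ℕ.* 2 ℕ.+ 1)             (ℕ-Solver.solve (j ∷ b ∷ u ∷ []))
           All.∷ below q≡ (u ℕ.+ 1)                   (b ℕ.* 2 ℕ.+ j ℕ.* 2 ℕ.+ 4) (ℕ-Solver.solve (j ∷ b ∷ u ∷ []))
           All.∷ All.[]

      B-run : ∀ c {b} → suc (b ℕ.+ c) ℕ.* 2 ≡ q → ρᴮ Q (ιℕ 0) ↝ ρᴮ Q (ιℕ c)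
      B-run zero    _  = ↝-reflexive refl
      B-run (suc c) {b} q≡ = ↝-trans (B-run c {suc b} q≡′) (B-step {c} {b} q≡′)
        where
        q≡′ : suc (suc (b ℕ.+ c)) ℕ.* 2 ≡ q
        q≡′ = ≡.trans (≡.cong (λ t → suc t ℕ.* 2) (≡.sym (ℕ.+-suc b c))) q≡

      odd-digits : ∀ {x} {X : Set x} → X → X → List (ℕExpr X)
      odd-digits m u = ⟨ u ⟩ ⊕ # 2 ∷ # 0 ∷ ⟨ m ⟩ ⊛ # 2 ⊕ # 3 ∷ ⟨ m ⟩ ⊛ # 2 ⊕ # 2
                     ∷ ⟨ m ⟩ ⊛ # 2 ⊕ # 4 ⊕ ⟨ u ⟩ ∷ []

      odd-exit : ∀ {m} → suc (suc m ℕ.* 2) ≡ q → ρᴬ Q (ιℕ (suc m)) ↝ ρ (ιℕ (suc m ℕ.* 2))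
      odd-exit {m} q≡ = _ , digits<n , ⇝-by-identity (odd-digits m u)
        (solve 6 (λ β N Q Q′ M U →
             β :^ 5 :* Syn.Root.ρᴬ β N Q (con (+ 1) :+ M)
          := Syn.value β (List.map ⌜_⌝ (odd-digits M U)) :+ Syn.Root.ρ β N Q′
             :+ ( ( (2 :× M :+ con (+ 3)) :* (β :+ con (+ 1)) :- (2 :× M :+ con (+ 2)) :* β :^ 4
                  :- (2 :× M :+ con (+ 3)) :* β :^ 3)
                  :* Syn.Root.cubic β N
                :+ (β :^ 4 :+ con (+ 1)) :* (N :- ⌜ ⟨ Q ⟩ ⊕ # 2 ⊕ ⟨ U ⟩ ⌝)
                :+ (β :^ 4 :+ con (+ 1) :- (β :- N) :* β :^ 5) :* (Q :- ⌜ # 1 ⊕ (# 1 ⊕ ⟨ M ⟩) ⊛ # 2 ⌝)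
                :+ (β :- N) :* (Q′ :- ⌜ (# 1 ⊕ ⟨ M ⟩) ⊛ # 2 ⌝)))
          refl β N Q (ιℕ (suc m ℕ.* 2)) (ιℕ m) (ιℕ u))
        (*₀ cubic≈0 +₀ *₀ (relation≈0 (⟨ q ⟩ ⊕ # 2 ⊕ ⟨ u ⟩) q+2+u≡n)
                    +₀ *₀ (relation≈0 (# 1 ⊕ (# 1 ⊕ ⟨ m ⟩) ⊛ # 2) q≡)
                    +₀ *₀ (relation≈0 ((# 1 ⊕ ⟨ m ⟩) ⊛ # 2) ≡.refl))
        where
        digits<n : All (ℕ._< n) (List.map ⟦_⟧ℕ (odd-digits m u))
        digits<n = below q≡ (u ℕ.+ 2)               (m ℕ.* 2 ℕ.+ 2)       (ℕ-Solver.solve (m ∷ u ∷ []))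
           All.∷ below q≡ 0                         (m ℕ.* 2 ℕ.+ 4 ℕ.+ u) (ℕ-Solver.solve (m ∷ u ∷ []))
           All.∷ below q≡ (m ℕ.* 2 ℕ.+ 3)           (u ℕ.+ 1)             (ℕ-Solver.solve (m ∷ u ∷ []))
           All.∷ below q≡ (m ℕ.* 2 ℕ.+ 2)           (u ℕ.+ 2)             (ℕ-Solver.solve (m ∷ u ∷ []))
           All.∷ below q≡ (m ℕ.* 2 ℕ.+ 4 ℕ.+ u)     0                     (ℕ-Solver.solve (m ∷ u ∷ []))
           All.∷ All.[]

      even-digits : ∀ {x} {X : Set x} → X → X → List (ℕExpr X)
      even-digits m u = ⟨ m ⟩ ⊛ # 2 ⊕ # 2 ⊕ ⟨ u ⟩ ∷ ⟨ m ⟩ ⊛ # 2 ⊕ # 1 ∷ ⟨ m ⟩ ⊛ # 2 ⊕ # 3 ∷ # 1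
                      ∷ ⟨ u ⟩ ⊕ # 2 ∷ ⟨ u ⟩ ⊕ # 2 ∷ # 0 ∷ ⟨ m ⟩ ⊛ # 2 ⊕ # 2 ∷ ⟨ m ⟩ ⊛ # 2 ⊕ # 1
                      ∷ ⟨ m ⟩ ⊛ # 2 ⊕ # 3 ⊕ ⟨ u ⟩ ∷ []

      even-exit : ∀ {m} → suc m ℕ.* 2 ≡ q → ρᴮ Q (ιℕ m) ↝ ρ (ιℕ (suc (m ℕ.* 2)))
      even-exit {m} q≡ = _ , digits<n , ⇝-by-identity (even-digits m u)
        (solve 6 (λ β N Q Q′ M U →
             β :^ 10 :* Syn.Root.ρᴮ β N Q M
          := Syn.value β (List.map ⌜_⌝ (even-digits M U)) :+ Syn.Root.ρ β N Q′
             :+ ( ( (2 :× M :+ con (+ 1)) :* β :^ 7 :+ (2 :× M :+ con (+ 3)) :* β :^ 6 :+ 2 :× β :^ 5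
                  :+ (2 :× M :+ con (+ 2)) :* (β :+ con (+ 1)) :- (2 :× M :+ con (+ 2)) :* β :^ 9
                  :- 2 :× β :^ 8 :- (2 :× M :+ con (+ 1)) :* β :^ 4 :- (2 :× M :+ con (+ 2)) :* β :^ 3)
                  :* Syn.Root.cubic β N
                :+ (β :^ 9 :+ β :^ 5 :+ β :^ 4 :+ con (+ 1)) :* (N :- ⌜ ⟨ Q ⟩ ⊕ # 2 ⊕ ⟨ U ⟩ ⌝)
                :+ (β :^ 10 :+ β :^ 9 :+ β :^ 5 :+ β :^ 4 :+ con (+ 1) :- (β :- N) :* β :^ 11)
                   :* (Q :- ⌜ (# 1 ⊕ ⟨ M ⟩) ⊛ # 2 ⌝)
                :+ (β :- N) :* (Q′ :- ⌜ # 1 ⊕ ⟨ M ⟩ ⊛ # 2 ⌝)))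
          refl β N Q (ιℕ (suc (m ℕ.* 2))) (ιℕ m) (ιℕ u))
        (*₀ cubic≈0 +₀ *₀ (relation≈0 (⟨ q ⟩ ⊕ # 2 ⊕ ⟨ u ⟩) q+2+u≡n)
                    +₀ *₀ (relation≈0 ((# 1 ⊕ ⟨ m ⟩) ⊛ # 2) q≡)
                    +₀ *₀ (relation≈0 (# 1 ⊕ ⟨ m ⟩ ⊛ # 2) ≡.refl))
        where
        digits<n : All (ℕ._< n) (List.map ⟦_⟧ℕ (even-digits m u))
        digits<n = below q≡ (m ℕ.* 2 ℕ.+ 2 ℕ.+ u)   1                     (ℕ-Solver.solve (m ∷ u ∷ []))
           All.∷ below q≡ (m ℕ.* 2 ℕ.+ 1)           (u ℕ.+ 2)             (ℕ-Solver.solve (m ∷ u ∷ []))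
           All.∷ below q≡ (m ℕ.* 2 ℕ.+ 3)           u                     (ℕ-Solver.solve (m ∷ u ∷ []))
           All.∷ below q≡ 1                         (m ℕ.* 2 ℕ.+ 2 ℕ.+ u) (ℕ-Solver.solve (m ∷ u ∷ []))
           All.∷ below q≡ (u ℕ.+ 2)                 (m ℕ.* 2 ℕ.+ 1)       (ℕ-Solver.solve (m ∷ u ∷ []))
           All.∷ below q≡ (u ℕ.+ 2)                 (m ℕ.* 2 ℕ.+ 1)       (ℕ-Solver.solve (m ∷ u ∷ []))
           All.∷ below q≡ 0                         (m ℕ.* 2 ℕ.+ 3 ℕ.+ u) (ℕ-Solver.solve (m ∷ u ∷ []))
           All.∷ below q≡ (m ℕ.* 2 ℕ.+ 2)           (u ℕ.+ 1)             (ℕ-Solver.solve (m ∷ u ∷ []))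
           All.∷ below q≡ (m ℕ.* 2 ℕ.+ 1)           (u ℕ.+ 2)             (ℕ-Solver.solve (m ∷ u ∷ []))
           All.∷ below q≡ (m ℕ.* 2 ℕ.+ 3 ℕ.+ u)     0                     (ℕ-Solver.solve (m ∷ u ∷ []))
           All.∷ All.[]

      last-digits : ∀ {x} {X : Set x} → X → X → List (ℕExpr X)
      last-digits u n = ⟨ u ⟩ ⊕ # 2 ∷ # 0 ∷ # 1 ∷ # 0 ∷ ⟨ n ⟩ ∷ # 0 ∷ []

      last-expansion : 1 ≡ q → Expansion (ρ Q)
      last-expansion q≡ = _ , admissible , ⇝-by-identity (last-digits u n)
        (solve 4 (λ β N Q U →
             β :^ 6 :* Syn.Root.ρ β N Q
          := Syn.value β (List.map ⌜_⌝ (last-digits U N)) :+ con (+ 0)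
             :+ ( (β :^ 2 :+ β :- β :^ 4) :* Syn.Root.cubic β N
                :+ β :^ 5 :* (N :- ⌜ ⟨ Q ⟩ ⊕ # 2 ⊕ ⟨ U ⟩ ⌝)
                :+ (β :^ 5 :- (β :- N) :* β :^ 6) :* (Q :- ⌜ # 1 ⌝)))
          refl β N Q (ιℕ u))
        (*₀ cubic≈0 +₀ *₀ (relation≈0 (⟨ q ⟩ ⊕ # 2 ⊕ ⟨ u ⟩) q+2+u≡n) +₀ *₀ (relation≈0 (# 1) q≡))
        where
        admissible : Admissible (List.map ⟦_⟧ℕ (last-digits u n))
        admissible = below q≡ (u ℕ.+ 2) 0       (ℕ-Solver.solve (u ∷ []))
                   ∷ below q≡ 0         (u ℕ.+ 2) (ℕ-Solver.solve (u ∷ []))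
                   ∷ below q≡ 1         (u ℕ.+ 1) (ℕ-Solver.solve (u ∷ []))
                   ∷ below q≡ 0         (u ℕ.+ 2) (ℕ-Solver.solve (u ∷ []))
                   ∷ n0∷ []

      odd-step : ∀ {m} → suc (suc m ℕ.* 2) ≡ q → ρ Q ↝ ρ (ιℕ (suc m ℕ.* 2))
      odd-step {m} q≡ = begin
        ρ Q                      ≈⟨ ρ≈ρᴬ0 ⟩
        ρᴬ Q (ιℕ 0)              ≲⟨ A-run (suc m) (ℕ.≤-trans (ℕ.n≤1+n _) (ℕ.≤-reflexive q≡)) ⟩
        ρᴬ Q (ιℕ (suc m))        ≲⟨ odd-exit {m} q≡ ⟩
        ρ (ιℕ (suc m ℕ.* 2))     ∎
        where open ↝-Reasoning

      even-step : ∀ {m} → suc m ℕ.* 2 ≡ q → ρ Q ↝ ρ (ιℕ (suc (m ℕ.* 2)))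
      even-step {m} q≡ = begin
        ρ Q                      ≈⟨ ρ≈ρᴬ0 ⟩
        ρᴬ Q (ιℕ 0)              ≲⟨ A-run (suc m) (ℕ.≤-reflexive q≡) ⟩
        ρᴬ Q (ιℕ (suc m))        ≈⟨ ρᴬ≈ρᴮ0 {suc m} q≡ ⟩
        ρᴮ Q (ιℕ 0)              ≲⟨ B-run m {0} q≡ ⟩
        ρᴮ Q (ιℕ m)              ≲⟨ even-exit {m} q≡ ⟩
        ρ (ιℕ (suc (m ℕ.* 2)))   ∎
        where open ↝-Reasoning

    ρ-step : ∀ q → suc (suc q) ℕ.+ 2 ℕ.≤ n → ρ (ιℕ (suc (suc q))) ↝ ρ (ιℕ (suc q))
    ρ-step q q+2≤n with parity q
    ... | even m = Stage.even-step (suc m ℕ.* 2) _ (ℕ.m+[n∸m]≡n q+2≤n) {m} ≡.refl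
    ... | odd m  = Stage.odd-step (suc (suc m ℕ.* 2)) _ (ℕ.m+[n∸m]≡n q+2≤n) {m} ≡.refl

    ρ-expansion : ∀ {q} → 1 ℕ.≤ q → q ℕ.+ 2 ℕ.≤ n → Expansion (ρ (ιℕ q))
    ρ-expansion {suc zero}    _ q+2≤n = Stage.last-expansion 1 _ (ℕ.m+[n∸m]≡n q+2≤n) ≡.refl
    ρ-expansion {suc (suc q)} _ q+2≤n =
      ↝-expansion (ρ-step q q+2≤n) (ρ-expansion (ℕ.s≤s ℕ.z≤n) (ℕ.≤-trans (ℕ.n≤1+n _) q+2≤n))

    -- The three ranges of k

    β≉0 : ¬ (β ≈ 0#)
    β≉0 β≈0 = irrefl (sym β≈0) 0<β

    β⁻¹ : Carrier
    β⁻¹ = proj₁ (inverse β β≉0)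

    ββ⁻¹-1≈0 : β * β⁻¹ - 1# ≈ 0#
    ββ⁻¹-1≈0 = trans (+-congʳ (proj₂ (inverse β β≉0))) (-‿inverseʳ 1#)

    β⁻¹-cancel : ∀ x → x * β⁻¹ * (β * 1#) ≈ x
    β⁻¹-cancel x = ≈-by-identity
      (solve 3 (λ β x b → x :* b :* β :^ 1 := x :+ x :* (β :* b :- con (+ 1))) refl β x β⁻¹)
      (*₀ ββ⁻¹-1≈0)

    β⁻²-cancel : ∀ x → x * (β⁻¹ * β⁻¹) * (β * (β * 1#)) ≈ x
    β⁻²-cancel x = ≈-by-identity
      (solve 3 (λ β x b → x :* (b :* b) :* β :^ 2 := x :+ x :* (β :* b :+ con (+ 1)) :* (β :* b :- con (+ 1)))
        refl β x β⁻¹)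
      (*₀ ββ⁻¹-1≈0)

    one-leading-digit : ∀ k → ιℕ k * β⁻¹ ⟨ k ∷ [] ⟩⇝ 0#
    one-leading-digit k = ⇝-by-identity (⟨ k ⟩ ∷ [])
      (solve 3 (λ β K b → β :^ 1 :* (K :* b) := Syn.value β (K ∷ []) :+ con (+ 0) :+ K :* (β :* b :- con (+ 1)))
        refl β (ιℕ k) β⁻¹)
      (*₀ ββ⁻¹-1≈0)

    two-leading-digits : ∀ {k} q s → 1 ℕ.+ s ℕ.+ q ℕ.* n ≡ k → ιℕ k * (β⁻¹ * β⁻¹) ⟨ q ∷ s ∷ [] ⟩⇝ ρ (ιℕ q)
    two-leading-digits {k} q s k≡ = ⇝-by-identity (⟨ q ⟩ ∷ ⟨ s ⟩ ∷ [])
      (solve 6 (λ β N K Q S b →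
           β :^ 2 :* (K :* (b :* b))
        := Syn.value β (Q ∷ S ∷ []) :+ Syn.Root.ρ β N Q
           :+ ( K :* (β :* b :+ con (+ 1)) :* (β :* b :- con (+ 1))
              :+ con (+ 1) :* (K :- ⌜ # 1 ⊕ ⟨ S ⟩ ⊕ ⟨ Q ⟩ ⊛ ⟨ N ⟩ ⌝)))
        refl β N (ιℕ k) (ιℕ q) (ιℕ s) β⁻¹)
      (*₀ ββ⁻¹-1≈0 +₀ *₀ (relation≈0 (# 1 ⊕ ⟨ s ⟩ ⊕ ⟨ q ⟩ ⊛ ⟨ n ⟩) k≡))

    one∈Fin : InFin β (ι (+ 1))
    one∈Fin = 0 , inj₂ (+-identityʳ 1#) , (λ _ ()) , 1# , trans (*-identityʳ 1#) (sym (+-identityʳ 1#)) ,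
              finiteDigits (2≤n ∷ 0<n ∷ n0∷ []) expansion
      where
      one-digits : ∀ {x} {X : Set x} → X → List (ℕExpr X)
      one-digits n = ⟨ n ⟩ ∷ # 1 ∷ # 0 ∷ ⟨ n ⟩ ∷ # 0 ∷ []
      expansion : 1# ⟨ List.map ⟦_⟧ℕ (one-digits n) ⟩⇝ 0#
      expansion = ⇝-by-identity (one-digits n)
        (solve 2 (λ β N →
             β :^ 5 :* con (+ 1)
          := Syn.value β (List.map ⌜_⌝ (one-digits N)) :+ con (+ 0) :+ (β :^ 2 :+ β) :* Syn.Root.cubic β N)
          refl β N)
        (*₀ cubic≈0)

    small∈Fin : ∀ k → 2 ℕ.≤ k → k ℕ.≤ n → InFin β (ι (+ k))
    small∈Fin k 2≤k k≤n =
      1 , k≤β , (λ { zero _ → <⇒≱ (1<ιℕ 2≤k) ; (suc _) (ℕ.s≤s ()) }) ,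
      ιℕ k * β⁻¹ , β⁻¹-cancel (ιℕ k) , finiteDigits [] (one-leading-digit k)
      where
      k≤β : ιℕ k ≤ β * 1#
      k≤β = ≤-trans (ιℕ-mono-≤ k≤n) (≤-trans (inj₁ n<β) (inj₂ (sym (*-identityʳ β))))

    large∈Fin : ∀ k → n ℕ.< k → k ℕ.≤ n ℕ.* (n ℕ.∸ 1) → InFin β (ι (+ k))
    large∈Fin k@(suc m) n<k k≤n[n-1] =
      2 , k≤β² , (λ { zero _ → k≰1 ; (suc zero) _ → k≰β ; (suc (suc _)) (ℕ.s≤s (ℕ.s≤s ())) }) ,
      ιℕ k * (β⁻¹ * β⁻¹) , β⁻²-cancel (ιℕ k) , digits-of (ρ-expansion (proj₁ q-bounds) (proj₂ q-bounds))
      where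
      instance
        n-nonZero : ℕ.NonZero n
        n-nonZero = ℕ.>-nonZero 0<n
      q : ℕ
      q = m ℕ./ n
      q-bounds : 1 ℕ.≤ q × q ℕ.+ 2 ℕ.≤ n
      q-bounds = quotient-bounds (ℕ.≤-pred n<k) k≤n[n-1]
      k≤β² : ιℕ k ≤ β * (β * 1#)
      k≤β² = begin
        ιℕ k          ≤⟨ ιℕ-mono-≤ (ℕ.≤-trans k≤n[n-1] (ℕ.*-monoʳ-≤ n (ℕ.m∸n≤m n 1))) ⟩
        ιℕ (n ℕ.* n)  ≈⟨ ιℕ-* n n ⟩
        N * N         ≤⟨ *-mono-≤ (0≤ιℕ n) (0≤ιℕ n) (inj₁ n<β) (inj₁ n<β) ⟩
        β * β         ≈⟨ *-congˡ (*-identityʳ β) ⟨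
        β * (β * 1#)  ∎
        where open <-Reasoning
      k≰1 : ¬ (ιℕ k ≤ 1#)
      k≰1 = <⇒≱ (1<ιℕ (ℕ.≤-trans 2≤n (ℕ.<⇒≤ n<k)))
      k≰β : ¬ (ιℕ k ≤ β * 1#)
      k≰β = <⇒≱ (<-≤-trans (<-respˡ-≈ (sym (*-identityʳ β)) β<n+1) (ιℕ-suc-≤ n<k))
      digits-of : Expansion (ρ (ιℕ q)) → FiniteDigits β (ιℕ k * (β⁻¹ * β⁻¹))
      digits-of (w , admissible , ρ⇝0) =
        finiteDigits (DivMod.m%n<n m n ∷ admissible)
          (⇝-++ (two-leading-digits q (m ℕ.% n) (≡.cong suc (≡.sym (DivMod.m≡m%n+[m/n]*n m n)))) ρ⇝0)

open import Data.Nat using (_≤_; _*_; _∸_)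

proposition2p3 : ∀ {c ℓ} (F : ArchOrderedField c ℓ) (n : ℕ) → 2 ≤ n → (β : ArchOrderedField.Carrier F) → BetaExpansion.IsLargestRoot F n β → (k : ℕ) → 1 ≤ k → k ≤ n * (n ∸ 1) → BetaExpansion.InFin F β (ArchOrderedField.ι F (+ k))
proposition2p3 F n 2≤n β (pβ , _) 1 _ _ = one∈Fin F n 2≤n β pβ
proposition2p3 F n 2≤n β (pβ , _) k@(suc (suc _)) _ k≤n[n-1] with k ℕ.≤? n
... | yes k≤n = small∈Fin F n 2≤n β pβ k (ℕ.s≤s (ℕ.s≤s ℕ.z≤n)) k≤n
... | no  k≰n = large∈Fin F n 2≤n β pβ k (ℕ.≰⇒> k≰n) k≤n[n-1]
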